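{- Let $q$ be a prime power and $n\ge1$, and let $F\in\mathbb{F}_{q^n}[x]$ satisfy $F^q-F=(x^{q^n}-x)F'$. If $\alpha x^k$ is a nonzero monomial of $F$, then $k=a_{n-1}q^{n-1}+a_{n-2}q^{n-2}+\cdots+a_1q+a_0$ with $a_i\in\{0,1\}$ for all $i$. -}

module Defs where

open import Level using (Level; _⊔_)
open import Data.Nat using (ℕ; zero; suc; _^_)
import Data.Nat as ℕ
open import Data.Nat.Primality using (Prime)
open import Data.Bool using (Bool; true; false)
open import Data.Fin using (Fin)
import Data.Fin as Fin
open import Data.List using (List; []; _∷_; map)
open import Data.Product using (∃; ∃-syntax; _×_)
open import Relation.Nullary using (¬_)
open import Relation.Binary.PropositionalEquality using (_≡_)
open import Algebra.Bundles using (CommutativeRing)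

IsPrimePower : ℕ → Set
IsPrimePower q = ∃[ p ] ∃[ k ] (Prime p × (1 ℕ.≤ k) × q ≡ p ^ k)

record IsField {c ℓ : Level} (R : CommutativeRing c ℓ) : Set (c ⊔ ℓ) where
  open CommutativeRing R
  field
    0≉1     : ¬ (0# ≈ 1#)
    inverse : ∀ x → ¬ (x ≈ 0#) → ∃[ y ] (x * y ≈ 1#)

bitValue : Bool → ℕ
bitValue true  = 1
bitValue false = 0

digitSum : (q n : ℕ) → (Fin n → Bool) → ℕ
digitSum q zero    a = 0
digitSum q (suc n) a = bitValue (a Fin.zero) ℕ.+ q ℕ.* digitSum q n (λ i → a (Fin.suc i))

-- Univariate polynomials over a commutative ring, as coefficient lists
-- (entry i = coefficient of x^i; trailing zeros allowed).
module Poly {c ℓ : Level} (R : CommutativeRing c ℓ) where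
  open CommutativeRing R

  Pol : Set c
  Pol = List Carrier

  coeff : Pol → ℕ → Carrier
  coeff []      _       = 0#
  coeff (a ∷ p) zero    = a
  coeff (a ∷ p) (suc i) = coeff p i

  _≈ₚ_ : Pol → Pol → Set ℓ
  p ≈ₚ r = ∀ i → coeff p i ≈ coeff r i

  _+ₚ_ : Pol → Pol → Pol
  []      +ₚ r       = r
  (a ∷ p) +ₚ []      = a ∷ p
  (a ∷ p) +ₚ (b ∷ r) = (a + b) ∷ (p +ₚ r)

  -ₚ_ : Pol → Pol
  -ₚ p = map -_ p

  _-ₚ_ : Pol → Pol → Pol
  p -ₚ r = p +ₚ (-ₚ r)

  scale : Carrier → Pol → Pol
  scale a p = map (a *_) p

  _*ₚ_ : Pol → Pol → Pol
  []      *ₚ r = []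
  (a ∷ p) *ₚ r = scale a r +ₚ (0# ∷ (p *ₚ r))

  _^ₚ_ : Pol → ℕ → Pol
  p ^ₚ zero  = 1# ∷ []
  p ^ₚ suc k = p *ₚ (p ^ₚ k)

  X : Pol
  X = 0# ∷ 1# ∷ []

  natMul : ℕ → Carrier → Carrier
  natMul zero    a = 0#
  natMul (suc k) a = a + natMul k a

  -- formal derivative: coefficient of x^(i) in p' is (i+1)·a_(i+1)
  derivFrom : ℕ → Pol → Pol
  derivFrom k []      = []
  derivFrom k (b ∷ p) = natMul k b ∷ derivFrom (suc k) p

  deriv : Pol → Pol
  deriv []      = []
  deriv (a ∷ p) = derivFrom 1 p

-- Write F = Σ aₖ xᵏ and N = qⁿ. A field with N elements has characteristic p, so
-- F^q = Σ aₖ^q x^(qk), and x·F′ has no term x^(qk). Comparing coefficients of x^(qk) gives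
-- a_(qk) = aₖ^q when qk < N, and aₖ^q − a_(qk) = a_(qk−N+1) when qk ≥ N; so if aₖ ≠ 0, then
-- a_(qk) ≠ 0 or a_(qk−N+1) ≠ 0. For k above the repunit S = 1 + q + ⋯ + q^(n−1) both indices
-- exceed k, so the support of F, being finite, lies in [0, S]. Then the leading base-q digit
-- of a k in the support is 0 or 1, and moving it to the units place gives again an element
-- of the support; after n such rotations every digit has been the leading one.

module Submission where

open import Level using (Level)
open import Data.Nat as ℕ using (ℕ; zero; suc; _≤_; _<_; z≤n; s≤s; nonTrivial⇒n>1)
import Data.Nat.Properties as ℕ
open import Data.Nat.Divisibility using (_∣_; divides; ∣⇒≤; ∣-trans; m∣m*n; ∣m⇒∣m*n; ∣m+n∣m⇒∣n)
open import Data.Nat.Primality using (Prime; euclidsLemma; ¬prime[0]; ¬prime[1]; prime⇒nonTrivial)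
open import Data.Nat.Combinatorics using (_C_; nCk+nC[k+1]≡[n+1]C[k+1]; nC1≡n; nCn≡1)
open import Data.Nat.Combinatorics.Specification using (k>n⇒nCk≡0)
open import Data.Nat.Tactic.RingSolver using (solve-∀)
open import Data.Bool using (Bool; true; false)
open import Data.Fin as Fin using (Fin; toℕ; inject₁; fromℕ)
open import Data.Fin.Properties using (toℕ-inject₁; toℕ<n; toℕ-fromℕ)
open import Data.Fin.Permutation using (Permutation; permutation)
open import Data.Vec.Functional using (head; last; tail; init)
open import Data.List using (List; []; _∷_; _++_; replicate; length)
open import Data.Product using (∃-syntax; _,_)
open import Data.Sum using (_⊎_; inj₁; inj₂; [_,_]′)
open import Relation.Nullary using (¬_; yes; no; contradiction)
open import Relation.Binary.Bundles using (Setoid)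
open import Relation.Binary.Definitions using (Decidable)
open import Relation.Binary.PropositionalEquality as ≡ using (_≡_; cong; cong₂)
import Relation.Binary.Reasoning.Setoid as SetoidReasoning
open import Function.Bundles using (Inverse)
open import Function.Properties.Inverse using (Inverse⇒Injection)
open import Relation.Nullary.Decidable using (via-injection)
open import Algebra.Bundles using (AbelianGroup; CommutativeMonoid; CommutativeSemiring; CommutativeRing)
open import Defs

[k+1]*[n+1]C[k+1]≡[n+1]*nCk : ∀ n k → suc k ℕ.* (suc n C suc k) ≡ suc n ℕ.* (n C k)
[k+1]*[n+1]C[k+1]≡[n+1]*nCk zero    zero    = ≡.refl
[k+1]*[n+1]C[k+1]≡[n+1]*nCk zero    (suc k) =
  ≡.trans (cong (suc (suc k) ℕ.*_) (k>n⇒nCk≡0 {1} {suc (suc k)} (s≤s (s≤s z≤n)))) (ℕ.*-zeroʳ (suc (suc k)))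
[k+1]*[n+1]C[k+1]≡[n+1]*nCk (suc n) zero    =
  ≡.trans (ℕ.+-identityʳ _) (≡.trans (nC1≡n (suc (suc n))) (≡.sym (ℕ.*-identityʳ (suc (suc n)))))
[k+1]*[n+1]C[k+1]≡[n+1]*nCk (suc n) (suc k) = begin
  suc (suc k) ℕ.* (suc (suc n) C suc (suc k))   ≡⟨ cong (suc (suc k) ℕ.*_) (nCk+nC[k+1]≡[n+1]C[k+1] (suc n) (suc k)) ⟨
  suc (suc k) ℕ.* (A ℕ.+ B)                     ≡⟨ regroup k A B ⟩
  A ℕ.+ suc k ℕ.* A ℕ.+ suc (suc k) ℕ.* B       ≡⟨ cong₂ (λ u v → A ℕ.+ u ℕ.+ v)
                                                     ([k+1]*[n+1]C[k+1]≡[n+1]*nCk n k) ([k+1]*[n+1]C[k+1]≡[n+1]*nCk n (suc k)) ⟩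
  A ℕ.+ suc n ℕ.* (n C k) ℕ.+ suc n ℕ.* (n C suc k) ≡⟨ ℕ.+-assoc A _ _ ⟩
  A ℕ.+ (suc n ℕ.* (n C k) ℕ.+ suc n ℕ.* (n C suc k)) ≡⟨ cong (A ℕ.+_) (ℕ.*-distribˡ-+ (suc n) (n C k) (n C suc k)) ⟨
  A ℕ.+ suc n ℕ.* (n C k ℕ.+ n C suc k)         ≡⟨ cong (λ z → A ℕ.+ suc n ℕ.* z) (nCk+nC[k+1]≡[n+1]C[k+1] n k) ⟩
  A ℕ.+ suc n ℕ.* A                             ∎
  where
  open ≡.≡-Reasoning
  A B : ℕ
  A = suc n C suc k
  B = suc n C suc (suc k)
  regroup : ∀ k A B → suc (suc k) ℕ.* (A ℕ.+ B) ≡ A ℕ.+ suc k ℕ.* A ℕ.+ suc (suc k) ℕ.* B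
  regroup = solve-∀

m∣m^n : ∀ {m n} → 1 ≤ n → m ∣ m ℕ.^ n
m∣m^n {m} {suc n} _ = m∣m*n (m ℕ.^ n)

1<prime^ : ∀ {p j} → Prime p → 1 ≤ j → 1 < p ℕ.^ j
1<prime^ {p} p-prime = ℕ.^-monoʳ-< p (nonTrivial⇒n>1 p {{prime⇒nonTrivial p-prime}})

prime∣pCk : ∀ {p k} → Prime p → 0 < k → k < p → p ∣ p C k
prime∣pCk {zero}  p-prime _ _ = contradiction p-prime ¬prime[0]
prime∣pCk {suc p} {suc k} p-prime _ k<p
  with euclidsLemma (suc k) (suc p C suc k) p-prime
         (divides (p C k) (≡.trans ([k+1]*[n+1]C[k+1]≡[n+1]*nCk p k) (ℕ.*-comm (suc p) (p C k))))
... | inj₁ p∣k+1 = contradiction (∣⇒≤ p∣k+1) (ℕ.<⇒≱ k<p)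
... | inj₂ p∣pCk = p∣pCk

module _ {a ℓ} (R : CommutativeSemiring a ℓ) where
  open CommutativeSemiring R
  open import Algebra.Properties.Semiring.Exp semiring using (_^_; ^-assocʳ; ^-congˡ)
  open import Algebra.Properties.Semiring.Mult semiring using (_×_; ×-congʳ; ×-assoc-*; ×1-homo-*)
  open import Algebra.Properties.Monoid.Sum +-monoid using (sum; sum-init-last; sum-cong-≋; sum-replicate-zero)
  open import Algebra.Properties.CommutativeSemiring.Binomial R using (theorem; binomialTerm)
  open SetoidReasoning setoid

  sum≈head+last : ∀ {n} (f : Fin (suc (suc n)) → Carrier) →
                  (∀ i → f (Fin.suc (inject₁ i)) ≈ 0#) → sum f ≈ head f + last f
  sum≈head+last {n} f inner≈0 = begin
    head f + sum (tail f)                              ≈⟨ +-congˡ (sum-init-last (tail f)) ⟩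
    head f + (sum (init (tail f)) + last f)            ≈⟨ +-congˡ (+-congʳ (sum-cong-≋ inner≈0)) ⟩
    head f + (sum {n} (λ _ → 0#) + last f)             ≈⟨ +-congˡ (+-congʳ (sum-replicate-zero n)) ⟩
    head f + (0# + last f)                             ≈⟨ +-congˡ (+-identityˡ (last f)) ⟩
    head f + last f                                    ∎

  ×≈×1#* : ∀ m x → m × x ≈ (m × 1#) * x
  ×≈×1#* m x = trans (×-congʳ m (sym (*-identityˡ x))) (sym (×-assoc-* m 1# x))

  p∣m⇒m×x≈0# : ∀ {p m} → p × 1# ≈ 0# → p ∣ m → ∀ x → m × x ≈ 0#
  p∣m⇒m×x≈0# {p} char (divides c ≡.refl) x = begin
    (c ℕ.* p) × x              ≈⟨ ×≈×1#* (c ℕ.* p) x ⟩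
    ((c ℕ.* p) × 1#) * x       ≈⟨ *-congʳ (×1-homo-* c p) ⟩
    ((c × 1#) * (p × 1#)) * x  ≈⟨ *-congʳ (*-congˡ char) ⟩
    ((c × 1#) * 0#) * x        ≈⟨ *-congʳ (zeroʳ (c × 1#)) ⟩
    0# * x                     ≈⟨ zeroˡ x ⟩
    0#                         ∎

  ×1-homo-^ : ∀ p m → (p ℕ.^ m) × 1# ≈ (p × 1#) ^ m
  ×1-homo-^ p zero    = +-identityʳ 1#
  ×1-homo-^ p (suc m) = trans (×1-homo-* p (p ℕ.^ m)) (*-congˡ (×1-homo-^ p m))

  ^p-distrib-+ : ∀ {p} → Prime p → p × 1# ≈ 0# → ∀ x y → (x + y) ^ p ≈ x ^ p + y ^ p
  ^p-distrib-+ {0}             p-prime = contradiction p-prime ¬prime[0]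
  ^p-distrib-+ {1}             p-prime = contradiction p-prime ¬prime[1]
  ^p-distrib-+ {p@(suc (suc n))} p-prime char x y = begin
    (x + y) ^ p             ≈⟨ theorem p x y ⟩
    sum t                   ≈⟨ sum≈head+last t inner≈0 ⟩
    head t + last t         ≈⟨ +-cong head≈ last≈ ⟩
    y ^ p + x ^ p           ≈⟨ +-comm (y ^ p) (x ^ p) ⟩
    x ^ p + y ^ p           ∎
    where
    t : Fin (suc p) → Carrier
    t = binomialTerm x y p
    head≈ : head t ≈ y ^ p
    head≈ = trans (+-identityʳ _) (*-identityˡ (y ^ p))
    last≈ : last t ≈ x ^ p
    last≈ = begin
      (p C toℕ (fromℕ p)) × (x ^ toℕ (fromℕ p) * y ^ (p ℕ.∸ toℕ (fromℕ p)))
        ≡⟨ cong (λ k → (p C k) × (x ^ k * y ^ (p ℕ.∸ k))) (toℕ-fromℕ p) ⟩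
      (p C p) × (x ^ p * y ^ (p ℕ.∸ p))  ≡⟨ cong₂ (λ c e → c × (x ^ p * y ^ e)) (nCn≡1 p) (ℕ.n∸n≡0 p) ⟩
      1 × (x ^ p * 1#)                   ≈⟨ +-identityʳ _ ⟩
      x ^ p * 1#                         ≈⟨ *-identityʳ (x ^ p) ⟩
      x ^ p                              ∎
    inner≈0 : ∀ i → t (Fin.suc (inject₁ i)) ≈ 0#
    inner≈0 i = p∣m⇒m×x≈0# char (prime∣pCk p-prime (s≤s z≤n) inner<p) _
      where
      inner<p : suc (toℕ (inject₁ i)) < p
      inner<p rewrite toℕ-inject₁ i = s≤s (toℕ<n i)

  ^[p^j]-distrib-+ : ∀ {p} → Prime p → p × 1# ≈ 0# →
                      ∀ j x y → (x + y) ^ (p ℕ.^ j) ≈ x ^ (p ℕ.^ j) + y ^ (p ℕ.^ j)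
  ^[p^j]-distrib-+         p-prime char zero    x y = distribʳ 1# x y
  ^[p^j]-distrib-+ {p} p-prime char (suc j) x y = begin
    (x + y) ^ (p ℕ.* p ℕ.^ j)                     ≈⟨ ^-assocʳ (x + y) p (p ℕ.^ j) ⟨
    ((x + y) ^ p) ^ (p ℕ.^ j)                     ≈⟨ ^-congˡ (p ℕ.^ j) (^p-distrib-+ p-prime char x y) ⟩
    (x ^ p + y ^ p) ^ (p ℕ.^ j)                   ≈⟨ ^[p^j]-distrib-+ p-prime char j (x ^ p) (y ^ p) ⟩
    (x ^ p) ^ (p ℕ.^ j) + (y ^ p) ^ (p ℕ.^ j)     ≈⟨ +-cong (^-assocʳ x p (p ℕ.^ j)) (^-assocʳ y p (p ℕ.^ j)) ⟩
    x ^ (p ℕ.* p ℕ.^ j) + y ^ (p ℕ.* p ℕ.^ j)     ∎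

module _ {c ℓ} (G : AbelianGroup c ℓ) where
  open AbelianGroup G
  open import Algebra.Properties.CommutativeMonoid.Sum commutativeMonoid
    using (sum; sum-permute; sum-cong-≋; ∑-distrib-+; sum-replicate)
  open import Algebra.Properties.Monoid.Mult monoid using (_×_)
  open import Algebra.Properties.Group group using (identityʳ-unique)
  open SetoidReasoning setoid

  -- Translating by g permutes G, so the sum of all elements absorbs N copies of g.
  card×≈ε : ∀ {N} → Inverse setoid (≡.setoid (Fin N)) → ∀ g → N × g ≈ ε
  card×≈ε {N} enum g = identityʳ-unique (sum from) (N × g) (begin
    sum from ∙ N × g                    ≈⟨ ∙-congˡ (sum-replicate N) ⟨
    sum from ∙ sum {N} (λ _ → g)        ≈⟨ ∑-distrib-+ from (λ _ → g) ⟨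
    sum (λ i → from i ∙ g)              ≈⟨ sum-cong-≋ (λ i → strictlyInverseʳ (from i ∙ g)) ⟨
    sum (λ i → from (translate g i))    ≈⟨ sum-permute from translation ⟨
    sum from                            ∎)
    where
    open Inverse enum using (to; from; to-cong; strictlyInverseˡ; strictlyInverseʳ)
    translate : Carrier → Fin N → Fin N
    translate h i = to (from i ∙ h)
    translate-cancel : ∀ {h h′} → h′ ∙ h ≈ ε → ∀ i → translate h (translate h′ i) ≡ i
    translate-cancel {h} {h′} h′h≈ε i = ≡.trans (to-cong (begin
      from (to (from i ∙ h′)) ∙ h     ≈⟨ ∙-congʳ (strictlyInverseʳ _) ⟩
      (from i ∙ h′) ∙ h               ≈⟨ assoc _ _ _ ⟩
      from i ∙ (h′ ∙ h)               ≈⟨ ∙-congˡ h′h≈ε ⟩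
      from i ∙ ε                      ≈⟨ identityʳ _ ⟩
      from i                          ∎)) (strictlyInverseˡ i)
    translation : Permutation N N
    translation = permutation (translate g) (translate (g ⁻¹)) (translate-cancel (inverseˡ g)) (translate-cancel (inverseʳ g))

module Polynomial {c ℓ} (K : CommutativeRing c ℓ) where
  open CommutativeRing K hiding (zero)
  open Poly K

  -- _≈ₚ_ unfolds to a Π-type from which Agda cannot recover the two polynomials;
  -- wrapped in a record they become inferable from a proof, so they can stay implicit.
  infix 4 _≋_
  record _≋_ (p r : Pol) : Set ℓ where
    constructor coeffwise
    field at : p ≈ₚ r
  open _≋_ public

  ≋-setoid : Setoid c ℓ
  ≋-setoid = record
    { Carrier = Pol ; _≈_ = _≋_
    ; isEquivalence = record
      { refl  = coeffwise λ _ → refl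
      ; sym   = λ p≋r → coeffwise λ i → sym (p≋r .at i)
      ; trans = λ p≋r r≋s → coeffwise λ i → trans (p≋r .at i) (r≋s .at i) } }

  open Setoid ≋-setoid public using () renaming (refl to ≋-refl; sym to ≋-sym; trans to ≋-trans)
  module ≋-Reasoning = SetoidReasoning ≋-setoid

  ∷-cong : ∀ {a b p r} → a ≈ b → p ≋ r → (a ∷ p) ≋ (b ∷ r)
  ∷-cong a≈b p≋r .at zero    = a≈b
  ∷-cong a≈b p≋r .at (suc i) = p≋r .at i

  coeff-+ₚ : ∀ p r i → coeff (p +ₚ r) i ≈ coeff p i + coeff r i
  coeff-+ₚ []      r       i       = sym (+-identityˡ _)
  coeff-+ₚ (a ∷ p) []      i       = sym (+-identityʳ _)
  coeff-+ₚ (a ∷ p) (b ∷ r) zero    = refl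
  coeff-+ₚ (a ∷ p) (b ∷ r) (suc i) = coeff-+ₚ p r i

  coeff-scale : ∀ a p i → coeff (scale a p) i ≈ a * coeff p i
  coeff-scale a []      i       = sym (zeroʳ a)
  coeff-scale a (b ∷ p) zero    = refl
  coeff-scale a (b ∷ p) (suc i) = coeff-scale a p i

  +ₚ-cong : ∀ {p p′ r r′} → p ≋ p′ → r ≋ r′ → (p +ₚ r) ≋ (p′ +ₚ r′)
  +ₚ-cong {p} {p′} {r} {r′} p≋p′ r≋r′ .at i =
    trans (coeff-+ₚ p r i) (trans (+-cong (p≋p′ .at i) (r≋r′ .at i)) (sym (coeff-+ₚ p′ r′ i)))

  +ₚ-assoc : ∀ p r s → ((p +ₚ r) +ₚ s) ≋ (p +ₚ (r +ₚ s))
  +ₚ-assoc p r s .at i = begin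
    coeff ((p +ₚ r) +ₚ s) i               ≈⟨ coeff-+ₚ (p +ₚ r) s i ⟩
    coeff (p +ₚ r) i + coeff s i          ≈⟨ +-congʳ (coeff-+ₚ p r i) ⟩
    coeff p i + coeff r i + coeff s i     ≈⟨ +-assoc _ _ _ ⟩
    coeff p i + (coeff r i + coeff s i)   ≈⟨ +-congˡ (coeff-+ₚ r s i) ⟨
    coeff p i + coeff (r +ₚ s) i          ≈⟨ coeff-+ₚ p (r +ₚ s) i ⟨
    coeff (p +ₚ (r +ₚ s)) i               ∎
    where open SetoidReasoning setoid

  +ₚ-comm : ∀ p r → (p +ₚ r) ≋ (r +ₚ p)
  +ₚ-comm p r .at i = trans (coeff-+ₚ p r i) (trans (+-comm _ _) (sym (coeff-+ₚ r p i)))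

  +ₚ-identityʳ : ∀ p → (p +ₚ []) ≋ p
  +ₚ-identityʳ p .at i = trans (coeff-+ₚ p [] i) (+-identityʳ _)

  +ₚ-commutativeMonoid : CommutativeMonoid c ℓ
  +ₚ-commutativeMonoid = record
    { Carrier = Pol ; _≈_ = _≋_ ; _∙_ = _+ₚ_ ; ε = []
    ; isCommutativeMonoid = record
      { isMonoid = record
        { isSemigroup = record
          { isMagma = record { isEquivalence = Setoid.isEquivalence ≋-setoid ; ∙-cong = +ₚ-cong }
          ; assoc = +ₚ-assoc }
        ; identity = (λ _ → ≋-refl) , +ₚ-identityʳ }
      ; comm = +ₚ-comm } }

  open import Algebra.Properties.CommutativeSemigroup (CommutativeMonoid.commutativeSemigroup +ₚ-commutativeMonoid)
    using () renaming (interchange to +ₚ-interchange; x∙yz≈y∙xz to +ₚ-exchange)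

  scale-cong : ∀ {a b p r} → a ≈ b → p ≋ r → scale a p ≋ scale b r
  scale-cong {a} {b} {p} {r} a≈b p≋r .at i =
    trans (coeff-scale a p i) (trans (*-cong a≈b (p≋r .at i)) (sym (coeff-scale b r i)))

  scale-distribˡ : ∀ a p r → scale a (p +ₚ r) ≋ (scale a p +ₚ scale a r)
  scale-distribˡ a p r .at i = begin
    coeff (scale a (p +ₚ r)) i                   ≈⟨ coeff-scale a (p +ₚ r) i ⟩
    a * coeff (p +ₚ r) i                         ≈⟨ *-congˡ (coeff-+ₚ p r i) ⟩
    a * (coeff p i + coeff r i)                  ≈⟨ distribˡ a _ _ ⟩
    a * coeff p i + a * coeff r i                ≈⟨ +-cong (coeff-scale a p i) (coeff-scale a r i) ⟨
    coeff (scale a p) i + coeff (scale a r) i    ≈⟨ coeff-+ₚ (scale a p) (scale a r) i ⟨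
    coeff (scale a p +ₚ scale a r) i             ∎
    where open SetoidReasoning setoid

  scale-distribʳ : ∀ a b r → scale (a + b) r ≋ (scale a r +ₚ scale b r)
  scale-distribʳ a b r .at i = begin
    coeff (scale (a + b) r) i                    ≈⟨ coeff-scale (a + b) r i ⟩
    (a + b) * coeff r i                          ≈⟨ distribʳ (coeff r i) a b ⟩
    a * coeff r i + b * coeff r i                ≈⟨ +-cong (coeff-scale a r i) (coeff-scale b r i) ⟨
    coeff (scale a r) i + coeff (scale b r) i    ≈⟨ coeff-+ₚ (scale a r) (scale b r) i ⟨
    coeff (scale a r +ₚ scale b r) i             ∎
    where open SetoidReasoning setoid

  scale-assoc : ∀ a b r → scale (a * b) r ≋ scale a (scale b r)
  scale-assoc a b r .at i = trans (coeff-scale (a * b) r i) (trans (*-assoc a b (coeff r i))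
    (sym (trans (coeff-scale a (scale b r) i) (*-congˡ (coeff-scale b r i)))))

  scale-≈0# : ∀ {a} r → a ≈ 0# → scale a r ≋ []
  scale-≈0# {a} r a≈0 .at i = trans (coeff-scale a r i) (trans (*-congʳ a≈0) (zeroˡ (coeff r i)))

  0#∷-≋[] : ∀ {p} → p ≋ [] → (0# ∷ p) ≋ []
  0#∷-≋[] p≋[] .at zero    = refl
  0#∷-≋[] p≋[] .at (suc i) = p≋[] .at i

  0#∷-+ₚ : ∀ p r → (0# ∷ (p +ₚ r)) ≋ ((0# ∷ p) +ₚ (0# ∷ r))
  0#∷-+ₚ p r = ∷-cong (sym (+-identityˡ 0#)) ≋-refl

  *ₚ-zeroʳ : ∀ p → (p *ₚ []) ≋ []
  *ₚ-zeroʳ []      = ≋-refl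
  *ₚ-zeroʳ (a ∷ p) = 0#∷-≋[] (*ₚ-zeroʳ p)

  ≋[]⇒*ₚ≋[] : ∀ {p} r → p ≋ [] → (p *ₚ r) ≋ []
  ≋[]⇒*ₚ≋[] {[]}    r p≋[] = ≋-refl
  ≋[]⇒*ₚ≋[] {a ∷ p} r p≋[] = +ₚ-cong (scale-≈0# r (p≋[] .at zero))
    (0#∷-≋[] (≋[]⇒*ₚ≋[] r (coeffwise {p} λ i → p≋[] .at (suc i))))

  *ₚ-congˡ : ∀ {p p′} r → p ≋ p′ → (p *ₚ r) ≋ (p′ *ₚ r)
  *ₚ-congˡ {[]}    {[]}      r p≋p′ = ≋-refl
  *ₚ-congˡ {[]}    {a′ ∷ p′} r p≋p′ = ≋-sym (≋[]⇒*ₚ≋[] r (≋-sym p≋p′))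
  *ₚ-congˡ {a ∷ p} {[]}      r p≋p′ = ≋[]⇒*ₚ≋[] r p≋p′
  *ₚ-congˡ {a ∷ p} {a′ ∷ p′} r p≋p′ =
    +ₚ-cong (scale-cong (p≋p′ .at zero) ≋-refl) (∷-cong refl (*ₚ-congˡ r (coeffwise {p} {p′} λ i → p≋p′ .at (suc i))))

  *ₚ-congʳ : ∀ p {r r′} → r ≋ r′ → (p *ₚ r) ≋ (p *ₚ r′)
  *ₚ-congʳ []      r≋r′ = ≋-refl
  *ₚ-congʳ (a ∷ p) r≋r′ = +ₚ-cong (scale-cong refl r≋r′) (∷-cong refl (*ₚ-congʳ p r≋r′))

  *ₚ-cong : ∀ {p p′ r r′} → p ≋ p′ → r ≋ r′ → (p *ₚ r) ≋ (p′ *ₚ r′)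
  *ₚ-cong {p′ = p′} {r} p≋p′ r≋r′ = ≋-trans (*ₚ-congˡ r p≋p′) (*ₚ-congʳ p′ r≋r′)

  *ₚ-∷ : ∀ p b r → (p *ₚ (b ∷ r)) ≋ (scale b p +ₚ (0# ∷ (p *ₚ r)))
  *ₚ-∷ []      b r = ≋-sym (0#∷-≋[] ≋-refl)
  *ₚ-∷ (a ∷ p) b r = ∷-cong (+-congʳ (*-comm a b)) (begin
    scale a r +ₚ (p *ₚ (b ∷ r))                    ≈⟨ +ₚ-cong ≋-refl (*ₚ-∷ p b r) ⟩
    scale a r +ₚ (scale b p +ₚ (0# ∷ (p *ₚ r)))    ≈⟨ +ₚ-exchange (scale a r) (scale b p) (0# ∷ (p *ₚ r)) ⟩
    scale b p +ₚ (scale a r +ₚ (0# ∷ (p *ₚ r)))    ∎)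
    where open ≋-Reasoning

  *ₚ-comm : ∀ p r → (p *ₚ r) ≋ (r *ₚ p)
  *ₚ-comm []      r = ≋-sym (*ₚ-zeroʳ r)
  *ₚ-comm (a ∷ p) r = ≋-trans (+ₚ-cong ≋-refl (∷-cong refl (*ₚ-comm p r))) (≋-sym (*ₚ-∷ r a p))

  *ₚ-distribʳ : ∀ r p p′ → ((p +ₚ p′) *ₚ r) ≋ ((p *ₚ r) +ₚ (p′ *ₚ r))
  *ₚ-distribʳ r []      p′        = ≋-refl
  *ₚ-distribʳ r (a ∷ p) []        = ≋-sym (+ₚ-identityʳ ((a ∷ p) *ₚ r))
  *ₚ-distribʳ r (a ∷ p) (b ∷ p′)  = begin
    scale (a + b) r +ₚ (0# ∷ ((p +ₚ p′) *ₚ r))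
      ≈⟨ +ₚ-cong (scale-distribʳ a b r) (≋-trans (∷-cong refl (*ₚ-distribʳ r p p′)) (0#∷-+ₚ (p *ₚ r) (p′ *ₚ r))) ⟩
    (scale a r +ₚ scale b r) +ₚ ((0# ∷ (p *ₚ r)) +ₚ (0# ∷ (p′ *ₚ r)))
      ≈⟨ +ₚ-interchange (scale a r) (scale b r) (0# ∷ (p *ₚ r)) (0# ∷ (p′ *ₚ r)) ⟩
    (scale a r +ₚ (0# ∷ (p *ₚ r))) +ₚ (scale b r +ₚ (0# ∷ (p′ *ₚ r)))  ∎
    where open ≋-Reasoning

  *ₚ-distribˡ : ∀ r p p′ → (r *ₚ (p +ₚ p′)) ≋ ((r *ₚ p) +ₚ (r *ₚ p′))
  *ₚ-distribˡ r p p′ = begin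
    r *ₚ (p +ₚ p′)              ≈⟨ *ₚ-comm r (p +ₚ p′) ⟩
    (p +ₚ p′) *ₚ r              ≈⟨ *ₚ-distribʳ r p p′ ⟩
    (p *ₚ r) +ₚ (p′ *ₚ r)       ≈⟨ +ₚ-cong (*ₚ-comm p r) (*ₚ-comm p′ r) ⟩
    (r *ₚ p) +ₚ (r *ₚ p′)       ∎
    where open ≋-Reasoning

  scale-*ₚ : ∀ a r s → (scale a r *ₚ s) ≋ scale a (r *ₚ s)
  scale-*ₚ a []      s = ≋-refl
  scale-*ₚ a (b ∷ r) s = begin
    scale (a * b) s +ₚ (0# ∷ (scale a r *ₚ s))       ≈⟨ +ₚ-cong (scale-assoc a b s) (∷-cong (sym (zeroʳ a)) (scale-*ₚ a r s)) ⟩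
    scale a (scale b s) +ₚ scale a (0# ∷ (r *ₚ s))   ≈⟨ scale-distribˡ a (scale b s) (0# ∷ (r *ₚ s)) ⟨
    scale a (scale b s +ₚ (0# ∷ (r *ₚ s)))           ∎
    where open ≋-Reasoning

  *ₚ-assoc : ∀ p r s → ((p *ₚ r) *ₚ s) ≋ (p *ₚ (r *ₚ s))
  *ₚ-assoc []      r s = ≋-refl
  *ₚ-assoc (a ∷ p) r s = begin
    (scale a r +ₚ (0# ∷ (p *ₚ r))) *ₚ s                          ≈⟨ *ₚ-distribʳ s (scale a r) (0# ∷ (p *ₚ r)) ⟩
    (scale a r *ₚ s) +ₚ (scale 0# s +ₚ (0# ∷ ((p *ₚ r) *ₚ s)))   ≈⟨ +ₚ-cong (scale-*ₚ a r s)
                                                                       (+ₚ-cong (scale-≈0# s refl) (∷-cong refl (*ₚ-assoc p r s))) ⟩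
    scale a (r *ₚ s) +ₚ (0# ∷ (p *ₚ (r *ₚ s)))                   ∎
    where open ≋-Reasoning

  *ₚ-identityˡ : ∀ p → ((1# ∷ []) *ₚ p) ≋ p
  *ₚ-identityˡ p .at i = begin
    coeff (scale 1# p +ₚ (0# ∷ [])) i          ≈⟨ coeff-+ₚ (scale 1# p) (0# ∷ []) i ⟩
    coeff (scale 1# p) i + coeff (0# ∷ []) i   ≈⟨ +-cong (coeff-scale 1# p i) (0#∷-≋[] ≋-refl .at i) ⟩
    1# * coeff p i + 0#                        ≈⟨ +-identityʳ _ ⟩
    1# * coeff p i                             ≈⟨ *-identityˡ (coeff p i) ⟩
    coeff p i                                  ∎
    where open SetoidReasoning setoid

  +ₚ-*ₚ-commutativeSemiring : CommutativeSemiring c ℓ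
  +ₚ-*ₚ-commutativeSemiring = record
    { Carrier = Pol ; _≈_ = _≋_ ; _+_ = _+ₚ_ ; _*_ = _*ₚ_ ; 0# = [] ; 1# = 1# ∷ []
    ; isCommutativeSemiring = record
      { isSemiring = record
        { isSemiringWithoutAnnihilatingZero = record
          { +-isCommutativeMonoid = CommutativeMonoid.isCommutativeMonoid +ₚ-commutativeMonoid
          ; *-cong = *ₚ-cong
          ; *-assoc = *ₚ-assoc
          ; *-identity = *ₚ-identityˡ , λ p → ≋-trans (*ₚ-comm p (1# ∷ [])) (*ₚ-identityˡ p)
          ; distrib = *ₚ-distribˡ , *ₚ-distribʳ }
        ; zero = (λ _ → ≋-refl) , *ₚ-zeroʳ }
      ; *-comm = *ₚ-comm } }

  open import Algebra.Properties.Semiring.Exp semiring using (_^_)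
  open import Algebra.Properties.Semiring.Mult semiring using (_×_)
  open import Algebra.Properties.Ring ring using (-0#≈0#; -1*x≈-x)
  open import Algebra.Properties.CommutativeSemiring.Exp +ₚ-*ₚ-commutativeSemiring using ()
    renaming (_^_ to _^ᴾ_; ^-distrib-* to ^ᴾ-distrib-*)
  open import Algebra.Properties.Semiring.Mult (CommutativeSemiring.semiring +ₚ-*ₚ-commutativeSemiring)
    using () renaming (_×_ to _×ᴾ_)

  ^ₚ≡^ᴾ : ∀ p m → p ^ₚ m ≡ p ^ᴾ m
  ^ₚ≡^ᴾ p zero    = ≡.refl
  ^ₚ≡^ᴾ p (suc m) = cong (p *ₚ_) (^ₚ≡^ᴾ p m)

  ^ₚ-congˡ : ∀ {p r} m → p ≋ r → (p ^ₚ m) ≋ (r ^ₚ m)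
  ^ₚ-congˡ zero    p≋r = ≋-refl
  ^ₚ-congˡ (suc m) p≋r = *ₚ-cong p≋r (^ₚ-congˡ m p≋r)

  ^ₚ-distrib-*ₚ : ∀ p r m → ((p *ₚ r) ^ₚ m) ≋ ((p ^ₚ m) *ₚ (r ^ₚ m))
  ^ₚ-distrib-*ₚ p r m rewrite ^ₚ≡^ᴾ (p *ₚ r) m | ^ₚ≡^ᴾ p m | ^ₚ≡^ᴾ r m = ^ᴾ-distrib-* p r m

  const-^ₚ : ∀ a m → ((a ∷ []) ^ₚ m) ≋ ((a ^ m) ∷ [])
  const-^ₚ a zero    = ≋-refl
  const-^ₚ a (suc m) = ≋-trans (*ₚ-congʳ (a ∷ []) (const-^ₚ a m)) (∷-cong (+-identityʳ _) ≋-refl)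

  X*ₚ : ∀ p → (X *ₚ p) ≋ (0# ∷ p)
  X*ₚ p = +ₚ-cong (scale-≈0# p refl) (∷-cong refl (*ₚ-identityˡ p))

  X^ₚ-*ₚ : ∀ n p → ((X ^ₚ n) *ₚ p) ≋ (replicate n 0# ++ p)
  X^ₚ-*ₚ zero    p = *ₚ-identityˡ p
  X^ₚ-*ₚ (suc n) p = begin
    (X *ₚ (X ^ₚ n)) *ₚ p      ≈⟨ *ₚ-assoc X (X ^ₚ n) p ⟩
    X *ₚ ((X ^ₚ n) *ₚ p)      ≈⟨ X*ₚ ((X ^ₚ n) *ₚ p) ⟩
    0# ∷ ((X ^ₚ n) *ₚ p)      ≈⟨ ∷-cong refl (X^ₚ-*ₚ n p) ⟩
    0# ∷ (replicate n 0# ++ p) ∎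
    where open ≋-Reasoning

  coeff-shift : ∀ n p i → coeff (replicate n 0# ++ p) (n ℕ.+ i) ≡ coeff p i
  coeff-shift zero    p i = ≡.refl
  coeff-shift (suc n) p i = coeff-shift n p i

  coeff-shift-< : ∀ n p {i} → i < n → coeff (replicate n 0# ++ p) i ≡ 0#
  coeff-shift-< (suc n) p {zero}  _         = ≡.refl
  coeff-shift-< (suc n) p {suc i} (s≤s i<n) = coeff-shift-< n p i<n

  ∷≋const+X* : ∀ a p → (a ∷ p) ≋ ((a ∷ []) +ₚ (X *ₚ p))
  ∷≋const+X* a p = ≋-sym (≋-trans (+ₚ-cong (≋-refl {a ∷ []}) (X*ₚ p)) (∷-cong (+-identityʳ a) ≋-refl))

  -- Additivity turns (a₀ + x·p)^Q into a₀^Q + x^Q·p^Q; induct on p.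
  coeff-^ₚ-at-multiple : ∀ Q → (∀ p r → ((p +ₚ r) ^ₚ Q) ≋ ((p ^ₚ Q) +ₚ (r ^ₚ Q))) →
                      ∀ p k → coeff (p ^ₚ Q) (Q ℕ.* k) ≈ coeff p k ^ Q
  coeff-^ₚ-at-multiple zero        additive p       k = refl
  coeff-^ₚ-at-multiple Q@(suc Q′)  additive []      k = sym (zeroˡ _)
  coeff-^ₚ-at-multiple Q@(suc Q′)  additive (a ∷ p) k = begin
    coeff ((a ∷ p) ^ₚ Q) (Q ℕ.* k)
      ≈⟨ ≋-trans (^ₚ-congˡ Q (∷≋const+X* a p)) (additive (a ∷ []) (X *ₚ p)) .at (Q ℕ.* k) ⟩
    coeff (((a ∷ []) ^ₚ Q) +ₚ ((X *ₚ p) ^ₚ Q)) (Q ℕ.* k)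
      ≈⟨ +ₚ-cong (const-^ₚ a Q) (≋-trans (^ₚ-distrib-*ₚ X p Q) (X^ₚ-*ₚ Q (p ^ₚ Q))) .at (Q ℕ.* k) ⟩
    coeff ((a ^ Q ∷ []) +ₚ (replicate Q 0# ++ (p ^ₚ Q))) (Q ℕ.* k)
      ≈⟨ coeff-+ₚ (a ^ Q ∷ []) (replicate Q 0# ++ (p ^ₚ Q)) (Q ℕ.* k) ⟩
    coeff (a ^ Q ∷ []) (Q ℕ.* k) + coeff (replicate Q 0# ++ (p ^ₚ Q)) (Q ℕ.* k)
      ≈⟨ split k ⟩
    coeff (a ∷ p) k ^ Q ∎
    where
    open SetoidReasoning setoid
    R : Pol
    R = replicate Q 0# ++ (p ^ₚ Q)
    split : ∀ k → coeff (a ^ Q ∷ []) (Q ℕ.* k) + coeff R (Q ℕ.* k) ≈ coeff (a ∷ p) k ^ Q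
    split zero    = begin
      coeff (a ^ Q ∷ []) (Q ℕ.* 0) + coeff R (Q ℕ.* 0)  ≡⟨ cong (λ m → coeff (a ^ Q ∷ []) m + coeff R m) (ℕ.*-zeroʳ Q) ⟩
      a ^ Q + 0#                                         ≈⟨ +-identityʳ (a ^ Q) ⟩
      a ^ Q                                              ∎
    split (suc k) = begin
      coeff (a ^ Q ∷ []) (Q ℕ.* suc k) + coeff R (Q ℕ.* suc k)
        ≡⟨ cong (λ m → coeff (a ^ Q ∷ []) m + coeff R m) (ℕ.*-suc Q k) ⟩
      0# + coeff R (Q ℕ.+ Q ℕ.* k)    ≡⟨ cong (0# +_) (coeff-shift Q (p ^ₚ Q) (Q ℕ.* k)) ⟩
      0# + coeff (p ^ₚ Q) (Q ℕ.* k)   ≈⟨ +-identityˡ _ ⟩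
      coeff (p ^ₚ Q) (Q ℕ.* k)        ≈⟨ coeff-^ₚ-at-multiple Q additive p k ⟩
      coeff p k ^ Q                   ∎


  coeff-negate : ∀ p i → coeff (-ₚ p) i ≈ - coeff p i
  coeff-negate []      i       = sym -0#≈0#
  coeff-negate (a ∷ p) zero    = refl
  coeff-negate (a ∷ p) (suc i) = coeff-negate p i

  coeff--ₚ : ∀ p r i → coeff (p -ₚ r) i ≈ coeff p i - coeff r i
  coeff--ₚ p r i = trans (coeff-+ₚ p (-ₚ r) i) (+-congˡ (coeff-negate r i))

  -ₚ≋scale-1# : ∀ p → (-ₚ p) ≋ scale (- 1#) p
  -ₚ≋scale-1# p .at i = trans (coeff-negate p i) (sym (trans (coeff-scale (- 1#) p i) (-1*x≈-x (coeff p i))))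

  *ₚ-distribʳ--ₚ : ∀ r p p′ → ((p -ₚ p′) *ₚ r) ≋ ((p *ₚ r) -ₚ (p′ *ₚ r))
  *ₚ-distribʳ--ₚ r p p′ = begin
    (p +ₚ (-ₚ p′)) *ₚ r               ≈⟨ *ₚ-distribʳ r p (-ₚ p′) ⟩
    (p *ₚ r) +ₚ ((-ₚ p′) *ₚ r)        ≈⟨ +ₚ-cong (≋-refl {p *ₚ r}) (begin
      (-ₚ p′) *ₚ r                       ≈⟨ *ₚ-congˡ r (-ₚ≋scale-1# p′) ⟩
      scale (- 1#) p′ *ₚ r               ≈⟨ scale-*ₚ (- 1#) p′ r ⟩
      scale (- 1#) (p′ *ₚ r)             ≈⟨ -ₚ≋scale-1# (p′ *ₚ r) ⟨
      -ₚ (p′ *ₚ r)                       ∎) ⟩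
    (p *ₚ r) +ₚ (-ₚ (p′ *ₚ r))        ∎
    where open ≋-Reasoning

  natMul≈× : ∀ m a → natMul m a ≈ m × a
  natMul≈× zero    a = refl
  natMul≈× (suc m) a = +-congˡ (natMul≈× m a)

  coeff-derivFrom : ∀ s p i → coeff (derivFrom s p) i ≈ (s ℕ.+ i) × coeff p i
  coeff-derivFrom s []      i       = sym (trans (×≈×1#* commutativeSemiring (s ℕ.+ i) 0#) (zeroʳ _))
  coeff-derivFrom s (b ∷ p) zero    = trans (natMul≈× s b) (reflexive (cong (_× b) (≡.sym (ℕ.+-identityʳ s))))
  coeff-derivFrom s (b ∷ p) (suc i) =
    trans (coeff-derivFrom (suc s) p i) (reflexive (cong (_× coeff p i) (≡.sym (ℕ.+-suc s i))))

  coeff-X*deriv : ∀ p m → coeff (0# ∷ deriv p) m ≈ m × coeff p m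
  coeff-X*deriv p       zero    = refl
  coeff-X*deriv []      (suc i) = sym (trans (×≈×1#* commutativeSemiring (suc i) 0#) (zeroʳ _))
  coeff-X*deriv (a ∷ p) (suc i) = coeff-derivFrom 1 p i

  coeff-×ᴾ : ∀ n p i → coeff (n ×ᴾ p) i ≈ n × coeff p i
  coeff-×ᴾ zero    p i = refl
  coeff-×ᴾ (suc n) p i = trans (coeff-+ₚ p (n ×ᴾ p) i) (+-congˡ (coeff-×ᴾ n p i))

  ×ᴾ-char : ∀ {n} → n × 1# ≈ 0# → n ×ᴾ (1# ∷ []) ≋ []
  ×ᴾ-char {n} char .at i = begin
    coeff (n ×ᴾ (1# ∷ [])) i      ≈⟨ coeff-×ᴾ n (1# ∷ []) i ⟩
    n × coeff (1# ∷ []) i         ≈⟨ ×≈×1#* commutativeSemiring n _ ⟩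
    (n × 1#) * coeff (1# ∷ []) i  ≈⟨ *-congʳ char ⟩
    0# * coeff (1# ∷ []) i        ≈⟨ zeroˡ _ ⟩
    0#                            ∎
    where open SetoidReasoning setoid

  coeff-≥length : ∀ p {i} → length p ≤ i → coeff p i ≡ 0#
  coeff-≥length []      _           = ≡.refl
  coeff-≥length (a ∷ p) (s≤s len≤i) = coeff-≥length p len≤i

finite⇒≈-decidable : ∀ {c ℓ} {S : Setoid c ℓ} {N} → Inverse S (≡.setoid (Fin N)) → Decidable (Setoid._≈_ S)
finite⇒≈-decidable enum = via-injection (Inverse⇒Injection enum) Fin._≟_

module _ {c ℓ} (K : CommutativeRing c ℓ) (K-field : IsField K) where
  open CommutativeRing K
  open IsField K-field
  open import Algebra.Properties.Semiring.Exp semiring using (_^_)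
  open import Algebra.Properties.Semiring.Mult semiring using (_×_)

  *-nonzero : ∀ {x y} → ¬ x ≈ 0# → ¬ y ≈ 0# → ¬ x * y ≈ 0#
  *-nonzero {x} {y} x≉0 y≉0 xy≈0 with inverse x x≉0
  ... | x⁻¹ , xx⁻¹≈1 = y≉0 (begin
    y              ≈⟨ *-identityˡ y ⟨
    1# * y         ≈⟨ *-congʳ (trans (sym xx⁻¹≈1) (*-comm x x⁻¹)) ⟩
    (x⁻¹ * x) * y  ≈⟨ *-assoc x⁻¹ x y ⟩
    x⁻¹ * (x * y)  ≈⟨ *-congˡ xy≈0 ⟩
    x⁻¹ * 0#       ≈⟨ zeroʳ x⁻¹ ⟩
    0#             ∎)
    where open SetoidReasoning setoid

  ^-nonzero : ∀ {x} → ¬ x ≈ 0# → ∀ m → ¬ x ^ m ≈ 0#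
  ^-nonzero x≉0 zero    1≈0 = 0≉1 (sym 1≈0)
  ^-nonzero x≉0 (suc m)     = *-nonzero x≉0 (^-nonzero x≉0 m)

  module _ {N} (enum : Inverse setoid (≡.setoid (Fin N))) where

    order≡p^m⇒p×1≈0# : ∀ p m → N ≡ p ℕ.^ m → p × 1# ≈ 0#
    order≡p^m⇒p×1≈0# p m N≡p^m with finite⇒≈-decidable enum (p × 1#) 0#
    ... | yes p×1≈0 = p×1≈0
    ... | no  p×1≉0 = contradiction (begin
      (p × 1#) ^ m          ≈⟨ ×1-homo-^ commutativeSemiring p m ⟨
      (p ℕ.^ m) × 1#        ≡⟨ cong (_× 1#) N≡p^m ⟨
      N × 1#                ≈⟨ card×≈ε +-abelianGroup enum 1# ⟩
      0#                    ∎) (^-nonzero p×1≉0 m)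
      where open SetoidReasoning setoid

module BinaryDigits where
  open import Data.Nat using (_+_; _*_; _^_; _<?_)
  open import Data.Nat.Properties
  open import Data.Product using (_×_)
  open ≡ using (refl; sym; trans; subst; module ≡-Reasoning)

  _∷ʳ_ : ∀ {j} → (Fin j → Bool) → Bool → Fin (suc j) → Bool
  _∷ʳ_ {zero}  a t _            = t
  _∷ʳ_ {suc j} a t Fin.zero     = a Fin.zero
  _∷ʳ_ {suc j} a t (Fin.suc i)  = ((λ i → a (Fin.suc i)) ∷ʳ t) i

  digitSum-∷ʳ : ∀ q j (a : Fin j → Bool) t →
                digitSum q (suc j) (a ∷ʳ t) ≡ digitSum q j a + bitValue t * q ^ j
  digitSum-∷ʳ q zero    a t =
    trans (cong (bitValue t +_) (*-zeroʳ q)) (trans (+-identityʳ _) (sym (*-identityʳ _)))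
  digitSum-∷ʳ q (suc j) a t = begin
    a₀ + q * digitSum q (suc j) (a′ ∷ʳ t)          ≡⟨ cong (λ z → a₀ + q * z) (digitSum-∷ʳ q j a′ t) ⟩
    a₀ + q * (digitSum q j a′ + bitValue t * q ^ j) ≡⟨ regroup a₀ q (digitSum q j a′) (bitValue t) (q ^ j) ⟩
    a₀ + q * digitSum q j a′ + bitValue t * (q * q ^ j) ∎
    where
    open ≡-Reasoning
    a₀ : ℕ
    a₀ = bitValue (a Fin.zero)
    a′ : Fin j → Bool
    a′ = λ i → a (Fin.suc i)
    regroup : ∀ a q D b Q → a + q * (D + b * Q) ≡ a + q * D + b * (q * Q)
    regroup = solve-∀

  module _ (r : ℕ) where

    q : ℕ
    q = suc (suc r)

    repunit : ℕ → ℕ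
    repunit m = digitSum q m (λ _ → true)

    q*repunit+1≡q^+repunit : ∀ m → q * repunit m + 1 ≡ q ^ m + repunit m
    q*repunit+1≡q^+repunit zero    = cong (_+ 1) (*-zeroʳ q)
    q*repunit+1≡q^+repunit (suc m) = begin
      q * (1 + q * R) + 1     ≡⟨ cong (λ z → q * z + 1) (+-comm 1 (q * R)) ⟩
      q * (q * R + 1) + 1     ≡⟨ cong (λ z → q * z + 1) (q*repunit+1≡q^+repunit m) ⟩
      q * (q ^ m + R) + 1     ≡⟨ cong (_+ 1) (*-distribˡ-+ q (q ^ m) R) ⟩
      q * q ^ m + q * R + 1   ≡⟨ +-assoc (q * q ^ m) (q * R) 1 ⟩
      q * q ^ m + (q * R + 1) ≡⟨ cong (q * q ^ m +_) (+-comm (q * R) 1) ⟩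
      q * q ^ m + (1 + q * R) ∎
      where
      open ≡-Reasoning
      R : ℕ
      R = repunit m

    repunit-suc : ∀ m → repunit (suc m) ≡ q ^ m + repunit m
    repunit-suc m = trans (+-comm 1 (q * repunit m)) (q*repunit+1≡q^+repunit m)

    repunit<q^ : ∀ m → repunit m < q ^ m
    repunit<q^ m = +-cancelˡ-≤ R (suc R) (q ^ m) (begin
      R + suc R       ≡⟨ double+1 R ⟩
      2 * R + 1       ≤⟨ +-monoˡ-≤ 1 (*-monoˡ-≤ R {2} {q} (s≤s (s≤s z≤n))) ⟩
      q * R + 1       ≡⟨ q*repunit+1≡q^+repunit m ⟩
      q ^ m + R       ≡⟨ +-comm (q ^ m) R ⟩
      R + q ^ m       ∎)
      where
      open ≤-Reasoning
      R : ℕ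
      R = repunit m
      double+1 : ∀ R → R + suc R ≡ 2 * R + 1
      double+1 = solve-∀

    drop-units-digit : ∀ {t ρ X ρ′ B} → t < q → t + q * ρ ≡ q * X + ρ′ → ρ′ < q * B →
                       ∃[ s ] (ρ ≡ X + s × s < B)
    drop-units-digit {t} {ρ} {X} {ρ′} {B} t<q eq ρ′<qB with ≤-<-connex X ρ
    ... | inj₂ ρ<X = contradiction (subst (q * X ≤_) (sym eq) (m≤m+n (q * X) ρ′)) (<⇒≱ (begin-strict
      t + q * ρ   <⟨ +-monoˡ-< (q * ρ) t<q ⟩
      q + q * ρ   ≡⟨ *-suc q ρ ⟨
      q * suc ρ   ≤⟨ *-monoʳ-≤ q ρ<X ⟩
      q * X       ∎))
      where open ≤-Reasoning
    ... | inj₁ X≤ρ with m≤n⇒∃[o]m+o≡n X≤ρ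
    ... | s , refl = s , refl , *-cancelˡ-< q s B (≤-<-trans (m≤m+n (q * s) t) (subst (_< q * B) ρ′≡ ρ′<qB))
      where
      regroup : ∀ t q X s → t + q * (X + s) ≡ q * X + (q * s + t)
      regroup = solve-∀
      ρ′≡ : ρ′ ≡ q * s + t
      ρ′≡ = sym (+-cancelˡ-≡ (q * X) _ _ (trans (sym (regroup t q X s)) eq))

    bitValue<q : ∀ t → bitValue t < q
    bitValue<q true  = s≤s (s≤s z≤n)
    bitValue<q false = s≤s z≤n

    m<q*m : ∀ {m} → 0 < m → m < q * m
    m<q*m {suc m} _ = m<m+n (suc m) (s≤s z≤n)

    module Support {ℓ} (n′ : ℕ) (P : ℕ → Set ℓ) (L : ℕ)
      (P⇒<L  : ∀ {k} → P k → k < L)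
      (P-below : ∀ {k} → P k → q * k < q ^ suc n′ → P (q * k))
      (P-above : ∀ {k i} → P k → q * k ≡ q ^ suc n′ + i → P (q * k) ⊎ P (suc i))
      where

      n : ℕ
      n = suc n′

      above-repunit : ∀ {k} → repunit n < k → ∃[ i ] (q * k ≡ q ^ n + i × k < suc i)
      above-repunit {k} S<k with m≤n⇒∃[o]m+o≡n S<k
      ... | d , refl = S + (suc r + q * d) , q*k≡ , s≤s (+-monoʳ-< S (s≤s (m≤n⇒m≤o+n r (m≤n*m d q))))
        where
        open ≡-Reasoning
        S : ℕ
        S = repunit n
        regroup₁ : ∀ r S d → suc (suc r) * (suc S + d) ≡ (suc r + suc (suc r) * d) + (suc (suc r) * S + 1)
        regroup₁ = solve-∀
        regroup₂ : ∀ A N S → A + (N + S) ≡ N + (S + A)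
        regroup₂ = solve-∀
        q*k≡ : q * (suc S + d) ≡ q ^ n + (S + (suc r + q * d))
        q*k≡ = begin
          q * (suc S + d)                   ≡⟨ regroup₁ r S d ⟩
          (suc r + q * d) + (q * S + 1)     ≡⟨ cong ((suc r + q * d) +_) (q*repunit+1≡q^+repunit n) ⟩
          (suc r + q * d) + (q ^ n + S)     ≡⟨ regroup₂ (suc r + q * d) (q ^ n) S ⟩
          q ^ n + (S + (suc r + q * d))     ∎

      -- Above the repunit, P-above always yields a larger element of P, which must stay below L.
      no-support-above : ∀ f {k} → L ≤ f + k → repunit n < k → ¬ P k
      no-support-above zero        L≤k _   Pk = <⇒≱ (P⇒<L Pk) L≤k
      no-support-above (suc f) {k} L≤  S<k Pk with above-repunit S<k
      ... | i , q*k≡ , k<i+1 = [ climb (m<q*m (≤-<-trans z≤n S<k)) , climb k<i+1 ]′ (P-above Pk q*k≡)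
        where
        climb : ∀ {k′} → k < k′ → ¬ P k′
        climb {k′} k<k′ = no-support-above f
          (≤-trans L≤ (subst (_≤ f + k′) (+-suc f k) (+-monoʳ-≤ f k<k′))) (<-trans S<k k<k′)

      P⇒≤repunit : ∀ {k} → P k → k ≤ repunit n
      P⇒≤repunit {k} Pk = ≮⇒≥ (λ S<k → no-support-above L (m≤m+n L k) S<k Pk)

      rotate-leading-bit : ∀ {k} → P k →
        ∃[ t ] ∃[ ρ ] (ρ < q ^ n′ × k ≡ bitValue t * q ^ n′ + ρ × P (bitValue t + q * ρ))
      rotate-leading-bit {k} Pk with k <? q ^ n′
      ... | yes k<Q = false , k , k<Q , refl , P-below Pk (*-monoʳ-< q k<Q)
      ... | no  k≮Q with m≤n⇒∃[o]m+o≡n (≮⇒≥ k≮Q)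
      ... | d , refl = true , d , d<Q , cong (_+ d) (sym (+-identityʳ Q)) , P-1+q*d
        where
        Q : ℕ
        Q = q ^ n′
        d<Q : d < Q
        d<Q = +-cancelˡ-< Q d Q (begin-strict
          Q + d              ≤⟨ P⇒≤repunit Pk ⟩
          repunit n          ≡⟨ repunit-suc n′ ⟩
          Q + repunit n′     <⟨ +-monoʳ-< Q (repunit<q^ n′) ⟩
          Q + Q              ∎)
          where open ≤-Reasoning
        q*k≡ : q * (Q + d) ≡ q ^ n + q * d
        q*k≡ = *-distribˡ-+ q Q d
        ¬P-q*k : ¬ P (q * (Q + d))
        ¬P-q*k P-q*k = <⇒≱ (<-≤-trans (repunit<q^ n) (subst (q ^ n ≤_) (sym q*k≡) (m≤m+n (q ^ n) (q * d))))
                            (P⇒≤repunit P-q*k)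
        P-1+q*d : P (1 + q * d)
        P-1+q*d = [ (λ P-q*k → contradiction P-q*k ¬P-q*k) , (λ P-1+q*d → P-1+q*d) ]′ (P-above Pk q*k≡)

      BinaryTop : ℕ → ℕ → ℕ → Set
      BinaryTop j e k = ∃[ a ] ∃[ ρ ] (ρ < q ^ e × k ≡ q ^ e * digitSum q j a + ρ)

      binaryTop : ∀ j {e} → j + e ≡ n → ∀ {k} → P k → BinaryTop j e k
      binaryTop zero    refl {k} Pk =
        (λ ()) , k , ≤-<-trans (P⇒≤repunit Pk) (repunit<q^ n) , cong (_+ k) (sym (*-zeroʳ (q ^ n)))
      binaryTop (suc j) {e} j+e≡n {k} Pk with rotate-leading-bit Pk
      ... | t , ρ , _ , k≡ , P-rot with binaryTop j (trans (+-suc j e) j+e≡n) P-rot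
      ... | a , ρ′ , ρ′<q*q^e , rot≡
        with drop-units-digit (bitValue<q t) (trans rot≡ (cong (_+ ρ′) (*-assoc q (q ^ e) _))) ρ′<q*q^e
      ... | s , ρ≡ , s<q^e = a ∷ʳ t , s , s<q^e , (begin
        k                                         ≡⟨ k≡ ⟩
        b * q ^ n′ + ρ                            ≡⟨ cong₂ (λ u v → b * u + v) q^n′≡ ρ≡ ⟩
        b * (q ^ j * q ^ e) + (q ^ e * D + s)     ≡⟨ regroup b (q ^ j) (q ^ e) D s ⟩
        q ^ e * (D + b * q ^ j) + s               ≡⟨ cong (λ z → q ^ e * z + s) (digitSum-∷ʳ q j a t) ⟨
        q ^ e * digitSum q (suc j) (a ∷ʳ t) + s   ∎)
        where
        open ≡-Reasoning
        b D : ℕ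
        b = bitValue t
        D = digitSum q j a
        q^n′≡ : q ^ n′ ≡ q ^ j * q ^ e
        q^n′≡ = trans (cong (q ^_) (sym (suc-injective j+e≡n))) (^-distribˡ-+-* q j e)
        regroup : ∀ b J E D s → b * (J * E) + (E * D + s) ≡ E * (D + b * J) + s
        regroup = solve-∀

      P⇒binary : ∀ {k} → P k → ∃[ a ] (k ≡ digitSum q n a)
      P⇒binary {k} Pk = fromBinaryTop (binaryTop n (+-identityʳ n) Pk)
        where
        fromBinaryTop : BinaryTop n 0 k → ∃[ a ] (k ≡ digitSum q n a)
        fromBinaryTop (a , ρ , ρ<1 , k≡) = a , trans k≡
          (trans (cong₂ _+_ (*-identityˡ (digitSum q n a)) (n<1⇒n≡0 ρ<1)) (+-identityʳ (digitSum q n a)))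

module FunctionalEquation {c ℓ} (K : CommutativeRing c ℓ) where
  open CommutativeRing K hiding (zero)
  open Poly K
  open Polynomial K
  open import Algebra.Properties.Semiring.Exp semiring using (_^_)
  open import Algebra.Properties.Semiring.Mult semiring using (_×_)
  open import Algebra.Properties.Ring ring using (-0#≈0#; x∙y⁻¹≈ε⇒x≈y)

  module Solution {p} (p-prime : Prime p) (char : p × 1# ≈ 0#)
    (j q : ℕ) (q≡p^j : q ≡ p ℕ.^ j) (1≤j : 1 ≤ j) (n : ℕ) (1≤n : 1 ≤ n) (F : Pol)
    (eqn : ((F ^ₚ q) -ₚ F) ≈ₚ (((X ^ₚ (q ℕ.^ n)) -ₚ X) *ₚ deriv F)) where

    N : ℕ
    N = q ℕ.^ n

    a : ℕ → Carrier
    a = coeff F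

    p∣q : p ∣ q
    p∣q = ≡.subst (p ∣_) (≡.sym q≡p^j) (m∣m^n 1≤j)

    p∣N : p ∣ N
    p∣N = ∣-trans p∣q (m∣m^n 1≤n)

    ^q-additive : ∀ r s → ((r +ₚ s) ^ₚ q) ≋ ((r ^ₚ q) +ₚ (s ^ₚ q))
    ^q-additive r s rewrite q≡p^j | ^ₚ≡^ᴾ (r +ₚ s) (p ℕ.^ j) | ^ₚ≡^ᴾ r (p ℕ.^ j) | ^ₚ≡^ᴾ s (p ℕ.^ j) =
      ^[p^j]-distrib-+ +ₚ-*ₚ-commutativeSemiring p-prime (×ᴾ-char {p} char) j r s

    coeff-F^q : ∀ k → coeff (F ^ₚ q) (q ℕ.* k) ≈ a k ^ q
    coeff-F^q = coeff-^ₚ-at-multiple q ^q-additive F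

    coeff-equation : ∀ m → coeff (F ^ₚ q) m - a m ≈ coeff (replicate N 0# ++ deriv F) m - m × a m
    coeff-equation m = begin
      coeff (F ^ₚ q) m - a m                                   ≈⟨ coeff--ₚ (F ^ₚ q) F m ⟨
      coeff ((F ^ₚ q) -ₚ F) m                                  ≈⟨ eqn m ⟩
      coeff (((X ^ₚ N) -ₚ X) *ₚ deriv F) m                     ≈⟨ *ₚ-distribʳ--ₚ (deriv F) (X ^ₚ N) X .at m ⟩
      coeff (((X ^ₚ N) *ₚ deriv F) -ₚ (X *ₚ deriv F)) m        ≈⟨ coeff--ₚ ((X ^ₚ N) *ₚ deriv F) (X *ₚ deriv F) m ⟩
      coeff ((X ^ₚ N) *ₚ deriv F) m - coeff (X *ₚ deriv F) m   ≈⟨ +-cong (X^ₚ-*ₚ N (deriv F) .at m)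
                                                                   (-‿cong (trans (X*ₚ (deriv F) .at m) (coeff-X*deriv F m))) ⟩
      coeff (replicate N 0# ++ deriv F) m - m × a m            ∎
      where open SetoidReasoning setoid

    coeff-equation-at-q*k : ∀ k → a k ^ q - a (q ℕ.* k) ≈ coeff (replicate N 0# ++ deriv F) (q ℕ.* k)
    coeff-equation-at-q*k k = begin
      a k ^ q - a (q ℕ.* k)                                       ≈⟨ +-congʳ (coeff-F^q k) ⟨
      coeff (F ^ₚ q) (q ℕ.* k) - a (q ℕ.* k)                      ≈⟨ coeff-equation (q ℕ.* k) ⟩
      coeff (replicate N 0# ++ deriv F) (q ℕ.* k) - (q ℕ.* k) × a (q ℕ.* k)
        ≈⟨ +-congˡ (-‿cong (p∣m⇒m×x≈0# commutativeSemiring char (∣m⇒∣m*n k p∣q) _)) ⟩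
      coeff (replicate N 0# ++ deriv F) (q ℕ.* k) - 0#            ≈⟨ +-congˡ -0#≈0# ⟩
      coeff (replicate N 0# ++ deriv F) (q ℕ.* k) + 0#            ≈⟨ +-identityʳ _ ⟩
      coeff (replicate N 0# ++ deriv F) (q ℕ.* k)                 ∎
      where open SetoidReasoning setoid

    coeff-below-N : ∀ {k} → q ℕ.* k < N → a (q ℕ.* k) ≈ a k ^ q
    coeff-below-N {k} qk<N =
      sym (x∙y⁻¹≈ε⇒x≈y _ _ (trans (coeff-equation-at-q*k k) (reflexive (coeff-shift-< N (deriv F) qk<N))))

    coeff-above-N : ∀ {k i} → q ℕ.* k ≡ N ℕ.+ i → a k ^ q - a (q ℕ.* k) ≈ a (suc i)
    coeff-above-N {k} {i} qk≡N+i = begin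
      a k ^ q - a (q ℕ.* k)                         ≈⟨ coeff-equation-at-q*k k ⟩
      coeff (replicate N 0# ++ deriv F) (q ℕ.* k)   ≡⟨ cong (coeff (replicate N 0# ++ deriv F)) qk≡N+i ⟩
      coeff (replicate N 0# ++ deriv F) (N ℕ.+ i)   ≡⟨ coeff-shift N (deriv F) i ⟩
      coeff (deriv F) i                             ≈⟨ coeff-X*deriv F (suc i) ⟩
      a (suc i) + i × a (suc i)                     ≈⟨ +-congˡ (p∣m⇒m×x≈0# commutativeSemiring char p∣i _) ⟩
      a (suc i) + 0#                                ≈⟨ +-identityʳ _ ⟩
      a (suc i)                                     ∎
      where
      open SetoidReasoning setoid
      p∣i : p ∣ i
      p∣i = ∣m+n∣m⇒∣n (≡.subst (p ∣_) qk≡N+i (∣m⇒∣m*n k p∣q)) p∣N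

    module NonzeroCoefficients (K-field : IsField K) (_≈?_ : Decidable _≈_) where

      Nonzero : ℕ → Set ℓ
      Nonzero m = ¬ a m ≈ 0#

      Nonzero⇒<length : ∀ {m} → Nonzero m → m < length F
      Nonzero⇒<length aₘ≉0 = ℕ.≰⇒> λ length≤m → aₘ≉0 (reflexive (coeff-≥length F length≤m))

      Nonzero-below : ∀ {k} → Nonzero k → q ℕ.* k < N → Nonzero (q ℕ.* k)
      Nonzero-below aₖ≉0 qk<N a[qk]≈0 = ^-nonzero K K-field aₖ≉0 q (trans (sym (coeff-below-N qk<N)) a[qk]≈0)

      Nonzero-above : ∀ {k i} → Nonzero k → q ℕ.* k ≡ N ℕ.+ i → Nonzero (q ℕ.* k) ⊎ Nonzero (suc i)
      Nonzero-above {k} aₖ≉0 qk≡N+i with a (q ℕ.* k) ≈? 0#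
      ... | no  a[qk]≉0 = inj₁ a[qk]≉0
      ... | yes a[qk]≈0 = inj₂ λ a[1+i]≈0 → ^-nonzero K K-field aₖ≉0 q
        (trans (x∙y⁻¹≈ε⇒x≈y _ _ (trans (coeff-above-N qk≡N+i) a[1+i]≈0)) a[qk]≈0)

open import Data.Nat using (_^_)
import Relation.Binary.PropositionalEquality as P

lemma4p6 : {c ℓ : Level} (q n : ℕ) → IsPrimePower q → 1 ≤ n →
  (K : CommutativeRing c ℓ) → IsField K →
  Inverse (CommutativeRing.setoid K) (P.setoid (Fin (q ^ n))) →
  (F : Poly.Pol K) →
  Poly._≈ₚ_ K (Poly._-ₚ_ K (Poly._^ₚ_ K F q) F)
             (Poly._*ₚ_ K (Poly._-ₚ_ K (Poly._^ₚ_ K (Poly.X K) (q ^ n)) (Poly.X K)) (Poly.deriv K F)) →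
  (k : ℕ) → ¬ (CommutativeRing._≈_ K (Poly.coeff K F k) (CommutativeRing.0# K)) →
  ∃[ a ] (k ≡ digitSum q n a)
lemma4p6 q zero _ () K K-field enum F eqn k aₖ≉0
lemma4p6 q n@(suc n′) (p , j , p-prime , 1≤j , q≡p^j) 1≤n K K-field enum F eqn k aₖ≉0
  -- Matching on 1 < q exposes q as 2 + r, the form BinaryDigits is stated for.
  with ≡.subst (1 <_) (≡.sym q≡p^j) (1<prime^ p-prime 1≤j)
... | s≤s (s≤s {n = r} _) = P⇒binary aₖ≉0
  where
  open FunctionalEquation.Solution K p-prime
    (order≡p^m⇒p×1≈0# K K-field enum p (j ℕ.* n) (≡.trans (cong (_^ n) q≡p^j) (ℕ.^-*-assoc p j n)))
    j q q≡p^j 1≤j n 1≤n F eqn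
  open NonzeroCoefficients K-field (finite⇒≈-decidable enum)
  open BinaryDigits.Support r n′ Nonzero (length F) Nonzero⇒<length Nonzero-below Nonzero-above
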